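{- Let $S\subseteq\mathbb{N}^\mathbb{N}$ and let $\alpha$ be an ordinal. Then $S$ is guessable with $<\alpha$ mind changes if and only if $S_\alpha=\emptyset$.
   Context: $\mathbb{N}^{<\mathbb{N}}$ is the set of finite sequences of naturals; $f\upharpoonright n$ is the length-$n$ initial segment of $f\in\mathbb{N}^\mathbb{N}$; $\chi_S$ is the characteristic function of $S$. A function $G:\mathbb{N}^{<\mathbb{N}}\to\{0,1\}$ is an $S$-guesser if $\lim_{n\to\infty}G(f\upharpoonright n)=\chi_S(f)$ for all $f\in\mathbb{N}^\mathbb{N}$. $G$ changes its mind on $f\upharpoonright(n+1)$ if $G(f\upharpoonright(n+1))\ne G(f\upharpoonright n)$. $S$ is guessable with $<\alpha$ mind changes if there are an $S$-guesser $G$ and a function $H:\mathbb{N}^{<\mathbb{N}}\to\alpha$ (i.e. with values ordinals $<\alpha$) such that for all $f\in\mathbb{N}^\mathbb{N}$, $n\in\mathbb{N}$: (i) $H(f\upharpoonright(n+1))\le H(f\upharpoonright n)$; (ii) if $G$ changes its mind on $f\upharpoonright(n+1)$ then $H(f\upharpoonright(n+1))<H(f\upharpoonright n)$. For $X\subseteq\mathbb{N}^{<\mathbb{N}}$, $[X]$ is the set of $f\in\mathbb{N}^\mathbb{N}$ all of whose finite initial segments lie in $X$. Define $S_\alpha\subseteq\mathbb{N}^{<\mathbb{N}}$ by: $S_0=\mathbb{N}^{<\mathbb{N}}$; $S_\lambda=\bigcap_{\beta<\lambda}S_\beta$ for limit $\lambda$; $S_{\beta+1}=\{x\in S_\beta: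 \exists x',x''\in[S_\beta] \text{ extending } x \text{ with } x'\in S,\ x''\notin S\}$. -}

module Defs where

open import Level using (0ℓ)
open import Data.Nat using (ℕ; suc; _≥_)
open import Data.Bool using (Bool; true; false)
open import Data.List using (List; map; upTo; length)
open import Data.Product using (Σ; ∃; _×_)
open import Data.Sum using (_⊎_)
open import Relation.Nullary using (¬_)
open import Relation.Binary using (Rel; IsStrictTotalOrder)
open import Relation.Binary.PropositionalEquality using (_≡_; _≢_)
open import Induction.WellFounded using (WellFounded; Acc; acc)

Baire : Set
Baire = ℕ → ℕ

Seq : Set
Seq = List ℕ

_↾_ : Baire → ℕ → Seq
f ↾ n = map f (upTo n)

-- An ordinal α, presented as a well-order (Carrier = the ordinals < α).
record Ordinal : Set₁ where
  field
    Carrier : Set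
    _<_     : Rel Carrier 0ℓ
    isStrictTotalOrder : IsStrictTotalOrder _≡_ _<_
    wellFounded        : WellFounded _<_

LimitIs : (ℕ → Bool) → Bool → Set
LimitIs s b = ∃ λ N → ∀ n → n ≥ N → s n ≡ b

IsGuesser : (Baire → Set) → (Seq → Bool) → Set
IsGuesser S G = ∀ f → (S f → LimitIs (λ n → G (f ↾ n)) true)
                    × (¬ S f → LimitIs (λ n → G (f ↾ n)) false)

GuessableBelow : (Baire → Set) → Ordinal → Set
GuessableBelow S α =
  Σ (Seq → Bool) λ G → Σ (Seq → Carrier) λ H →
    IsGuesser S G ×
    (∀ f n → (H (f ↾ suc n) < H (f ↾ n) ⊎ H (f ↾ suc n) ≡ H (f ↾ n))
           × (G (f ↾ suc n) ≢ G (f ↾ n) → H (f ↾ suc n) < H (f ↾ n)))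
  where open Ordinal α

Body : (Seq → Set) → Baire → Set
Body X f = ∀ n → X (f ↾ n)

Extends : Baire → Seq → Set
Extends f x = f ↾ length x ≡ x

Deriv : (Baire → Set) → (Seq → Set) → Seq → Set
Deriv S T x = T x × ∃ λ f → ∃ λ g →
  Body T f × Extends f x × S f × Body T g × Extends g x × ¬ S g

module _ (S : Baire → Set) (α : Ordinal) where
  open Ordinal α

  -- S_β = ⋂_{γ<β} D(S_γ)  (equivalent to the successor/limit definition)
  stageAcc : (β : Carrier) → Acc _<_ β → Seq → Set
  stageAcc β (acc rs) x = ∀ {γ} (p : γ < β) → Deriv S (stageAcc γ (rs p)) x

  stage : Carrier → Seq → Set
  stage β = stageAcc β (wellFounded β)

  stageTop : Seq → Set
  stageTop x = ∀ γ → Deriv S (stage γ) x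

{-# OPTIONS --safe #-}
-- (⇒) If x ∈ D(T), the two branches of [T] through x have different limit guesses, so along one
-- of them the guess eventually differs from G x and H must drop: some y ∈ T has H y < H x. By
-- well-founded induction no x ∈ S_β has H x < β, whereas x ∈ S_α would lie in D(S_{H x}).
-- (⇐) Classically, let rank x be the least γ with x ∉ D(S_γ); it exists as S_α = ∅, x ∈ S_{rank x},
-- and the rank does not increase along a branch f, so it is eventually some constant β and
-- f ∈ [S_β]. Since x ∉ D(S_{rank x}), the branches of [S_{rank x}] through x are either all in S
-- or all outside S, so guessing from them is eventually right, and rank itself counts the mind
-- changes.
module Submission where

open import Defs
open import Level using (0ℓ)
open import Axiom.ExcludedMiddle using (ExcludedMiddle)
open import Axiom.DoubleNegationElimination using (em⇒dne)
open import Function using (_∘_)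
open import Function.Bundles using (_⇔_; mk⇔; Equivalence)
import Function.Properties.Equivalence as ⇔
open import Relation.Nullary using (¬_; does; yes; no)
open import Relation.Nullary.Decidable using (dec-true; dec-false; does-⇔)
open import Data.Nat using (ℕ; zero; suc; _+_; _≤_; z≤n; s≤s)
open import Data.Nat.Properties using (≤-refl; n≤1+n; m≤n⇒m≤1+n; m≤m+n; m≤n⇒m<n∨m≡n)
open import Data.Bool using (Bool; true; false; _≟_)
open import Data.Bool.Properties using (not-¬)
open import Data.List using (_∷_; take; applyUpTo; upTo; length)
open import Data.List.Properties using (length-map; length-upTo; map-upTo)
open import Data.Product using (Σ; _×_; _,_; proj₁; proj₂)
open import Data.Sum using (_⊎_; inj₁; inj₂)
open import Data.Empty using (⊥-elim)
open import Relation.Binary using (Rel; tri<; tri≈; tri>; IsStrictTotalOrder)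
open import Relation.Binary.PropositionalEquality
open import Induction.WellFounded using (WellFounded; Acc; acc)

wellFounded-minimal : ExcludedMiddle 0ℓ → {A : Set} {_<_ : Rel A 0ℓ} → WellFounded _<_ →
                      (P : A → Set) → ¬ (∀ a → ¬ P a) →
                      Σ A λ m → P m × (∀ {a} → a < m → ¬ P a)
wellFounded-minimal em {A} {_<_} wf P nonempty with em {Σ A λ m → P m × (∀ {a} → a < m → ¬ P a)}
... | yes minimal = minimal
... | no none = ⊥-elim (nonempty (λ a → absent a (wf a)))
  where
  absent : ∀ a → Acc _<_ a → ¬ P a
  absent a (acc rs) pa = none (a , pa , λ b<a → absent _ (rs b<a))

length-↾ : ∀ f n → length (f ↾ n) ≡ n
length-↾ f n = trans (length-map f (upTo n)) (length-upTo n)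

take-applyUpTo : ∀ {A : Set} (f : ℕ → A) {m n} → n ≤ m → take n (applyUpTo f m) ≡ applyUpTo f n
take-applyUpTo f z≤n       = refl
take-applyUpTo f (s≤s n≤m) = cong (f 0 ∷_) (take-applyUpTo (f ∘ suc) n≤m)

take-↾ : ∀ f {m n} → n ≤ m → take n (f ↾ m) ≡ f ↾ n
take-↾ f {m} {n} n≤m = begin
  take n (f ↾ m)         ≡⟨ cong (take n) (map-upTo f m) ⟩
  take n (applyUpTo f m) ≡⟨ take-applyUpTo f n≤m ⟩
  applyUpTo f n          ≡⟨ map-upTo f n ⟨
  f ↾ n                  ∎
  where open ≡-Reasoning

extends-↾ : ∀ {g} f {m n} → n ≤ m → Extends g (f ↾ m) → Extends g (f ↾ n)
extends-↾ {g} f {m} {n} n≤m g⊒f↾m = begin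
  g ↾ length (f ↾ n) ≡⟨ cong (g ↾_) (length-↾ f n) ⟩
  g ↾ n              ≡⟨ take-↾ g n≤m ⟨
  take n (g ↾ m)     ≡⟨ cong (take n) (trans (sym (cong (g ↾_) (length-↾ f m))) g⊒f↾m) ⟩
  take n (f ↾ m)     ≡⟨ take-↾ f n≤m ⟩
  f ↾ n              ∎
  where open ≡-Reasoning

extends-self : ∀ f n → Extends f (f ↾ n)
extends-self f n = cong (f ↾_) (length-↾ f n)

Deriv-mono : ∀ S {T T′ : Seq → Set} → (∀ {y} → T y → T′ y) → ∀ {x} → Deriv S T x → Deriv S T′ x
Deriv-mono S T⊆T′ (tx , f , g , bf , ef , sf , bg , eg , ¬sg) =
  T⊆T′ tx , f , g , T⊆T′ ∘ bf , ef , sf , T⊆T′ ∘ bg , eg , ¬sg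

Deriv-↾ : ∀ S {T : Seq → Set} f {m n} → n ≤ m → T (f ↾ n) → Deriv S T (f ↾ m) → Deriv S T (f ↾ n)
Deriv-↾ S f n≤m tx (_ , g , h , bg , eg , sg , bh , eh , ¬sh) =
  tx , g , h , bg , extends-↾ f n≤m eg , sg , bh , extends-↾ f n≤m eh , ¬sh

module Stages (S : Baire → Set) (α : Ordinal) where
  open Ordinal α
  open IsStrictTotalOrder isStrictTotalOrder using (compare)

  stageAcc-irrelevant : ∀ {β} (a b : Acc _<_ β) {x} → stageAcc S α β a x → stageAcc S α β b x
  stageAcc-irrelevant (acc rs) (acc rs′) s γ<β =
    Deriv-mono S (stageAcc-irrelevant (rs γ<β) (rs′ γ<β)) (s γ<β)

  stageAcc-intro : ∀ {β x} (a : Acc _<_ β) →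
                   (∀ {γ} → γ < β → Deriv S (stage S α γ) x) → stageAcc S α β a x
  stageAcc-intro (acc rs) d γ<β = Deriv-mono S (stageAcc-irrelevant (wellFounded _) (rs γ<β)) (d γ<β)

  stageAcc-elim : ∀ {β γ x} (a : Acc _<_ β) → stageAcc S α β a x → γ < β → Deriv S (stage S α γ) x
  stageAcc-elim (acc rs) s γ<β = Deriv-mono S (stageAcc-irrelevant (rs γ<β) (wellFounded _)) (s γ<β)

  stage-antitone : ∀ {β γ x} → ¬ β < γ → stage S α β x → stage S α γ x
  stage-antitone {β} {γ} β≮γ s with compare γ β
  ... | tri< γ<β _ _ = proj₁ (stageAcc-elim (wellFounded β) s γ<β)
  ... | tri≈ _ refl _ = s
  ... | tri> _ _ β<γ = ⊥-elim (β≮γ β<γ)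

CountsMindChanges : (α : Ordinal) → (Seq → Bool) → (Seq → Ordinal.Carrier α) → Set
CountsMindChanges α G H = ∀ f n → (H (f ↾ suc n) < H (f ↾ n) ⊎ H (f ↾ suc n) ≡ H (f ↾ n))
                                × (G (f ↾ suc n) ≢ G (f ↾ n) → H (f ↾ suc n) < H (f ↾ n))
  where open Ordinal α

module MindChangeBound (S : Baire → Set) (α : Ordinal) (G : Seq → Bool) (H : Seq → Ordinal.Carrier α)
  (guesses : IsGuesser S G)
  (counts : CountsMindChanges α G H)
  where
  open Ordinal α
  open IsStrictTotalOrder isStrictTotalOrder using () renaming (trans to <-trans)

  _⇝_ : Seq → Seq → Set
  x ⇝ y = H y < H x ⊎ (H y ≡ H x × G y ≡ G x)

  ⇝-trans : ∀ {x y z} → x ⇝ y → y ⇝ z → x ⇝ z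
  ⇝-trans (inj₁ Hy<Hx)        (inj₁ Hz<Hy)            = inj₁ (<-trans Hz<Hy Hy<Hx)
  ⇝-trans {x} (inj₁ Hy<Hx)    (inj₂ (Hz≡Hy , _))      = inj₁ (subst (_< H x) (sym Hz≡Hy) Hy<Hx)
  ⇝-trans {z = z} (inj₂ (Hy≡Hx , _)) (inj₁ Hz<Hy)       = inj₁ (subst (H z <_) Hy≡Hx Hz<Hy)
  ⇝-trans (inj₂ (Hy≡Hx , Gy≡Gx)) (inj₂ (Hz≡Hy , Gz≡Gy)) = inj₂ (trans Hz≡Hy Hy≡Hx , trans Gz≡Gy Gy≡Gx)

  ⇝-suc : ∀ f n → (f ↾ n) ⇝ (f ↾ suc n)
  ⇝-suc f n with G (f ↾ suc n) ≟ G (f ↾ n) | counts f n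
  ... | no changed | _ , drops    = inj₁ (drops changed)
  ... | yes same   | inj₁ drop , _ = inj₁ drop
  ... | yes same   | inj₂ stay , _ = inj₂ (stay , same)

  ⇝-+ : ∀ f k n → (f ↾ n) ⇝ (f ↾ (k + n))
  ⇝-+ f zero    n = inj₂ (refl , refl)
  ⇝-+ f (suc k) n = ⇝-trans (⇝-+ f k n) (⇝-suc f (k + n))

  escape-along : ∀ {T : Seq → Set} {h x b} → Body T h → Extends h x →
                 LimitIs (λ n → G (h ↾ n)) b → G x ≢ b → Σ Seq λ y → T y × H y < H x
  escape-along {h = h} {x} bh h⊒x (N , limit) Gx≢b
    with subst (_⇝ (h ↾ (N + length x))) h⊒x (⇝-+ h N (length x))
  ... | inj₁ drop = _ , bh _ , drop
  ... | inj₂ (_ , same) = ⊥-elim (Gx≢b (trans (sym same) (limit _ (m≤m+n N (length x)))))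

  Deriv-escape : ∀ {T x} → Deriv S T x → Σ Seq λ y → T y × H y < H x
  Deriv-escape {x = x} (_ , f , g , bf , ef , sf , bg , eg , ¬sg) with G x in Gx
  ... | true  = escape-along bg eg (proj₂ (guesses g) ¬sg) (not-¬ Gx)
  ... | false = escape-along bf ef (proj₁ (guesses f) sf) (not-¬ Gx)

  stageAcc⇒H≮ : ∀ β (a : Acc _<_ β) {x} → stageAcc S α β a x → ¬ H x < β
  stageAcc⇒H≮ β (acc rs) {x} s Hx<β with Deriv-escape (s Hx<β)
  ... | _ , sy , Hy<Hx = stageAcc⇒H≮ (H x) (rs Hx<β) sy Hy<Hx

  stageTop-empty : ∀ x → ¬ stageTop S α x
  stageTop-empty x top with Deriv-escape (top (H x))
  ... | _ , sy , Hy<Hx = stageAcc⇒H≮ (H x) (wellFounded (H x)) sy Hy<Hx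

module RankGuesser (em : ExcludedMiddle 0ℓ) (S : Baire → Set) (α : Ordinal)
  (stageTop-empty : ∀ x → ¬ stageTop S α x) where
  open Ordinal α
  open IsStrictTotalOrder isStrictTotalOrder using (compare)
  open Stages S α

  Branch : (Baire → Set) → Carrier → Seq → Set
  Branch P β x = Σ Baire λ g → Body (stage S α β) g × Extends g x × P g

  Branch-↾ : ∀ {P β} f {m n} → n ≤ m → Branch P β (f ↾ m) → Branch P β (f ↾ n)
  Branch-↾ f n≤m (g , bg , eg , pg) = g , bg , extends-↾ f n≤m eg , pg

  least-underived : ∀ x → Σ Carrier λ ρ → ¬ Deriv S (stage S α ρ) x
                                        × (∀ {γ} → γ < ρ → ¬ ¬ Deriv S (stage S α γ) x)
  least-underived x = wellFounded-minimal em wellFounded (λ γ → ¬ Deriv S (stage S α γ) x)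
                        (λ all-derived → stageTop-empty x (λ γ → em⇒dne em (all-derived γ)))

  rank : Seq → Carrier
  rank x = proj₁ (least-underived x)

  underived-rank : ∀ x → ¬ Deriv S (stage S α (rank x)) x
  underived-rank x = proj₁ (proj₂ (least-underived x))

  stage-rank : ∀ x → stage S α (rank x) x
  stage-rank x = stageAcc-intro (wellFounded _) (em⇒dne em ∘ proj₂ (proj₂ (least-underived x)))

  rank-unsplit : ∀ x → Branch S (rank x) x → ¬ Branch (¬_ ∘ S) (rank x) x
  rank-unsplit x (g , bg , eg , sg) (h , bh , eh , ¬sh) =
    underived-rank x (stage-rank x , g , h , bg , eg , sg , bh , eh , ¬sh)

  rank-antitone : ∀ f {m n} → n ≤ m → ¬ rank (f ↾ n) < rank (f ↾ m)
  rank-antitone f {m} {n} n≤m lt = proj₂ (proj₂ (least-underived (f ↾ m))) lt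
    (λ derived → underived-rank (f ↾ n)
                   (Deriv-↾ S {T = stage S α (rank (f ↾ n))} f n≤m (stage-rank (f ↾ n)) derived))

  eventual-rank : ∀ f → Σ Carrier λ β → Σ ℕ λ N →
                  (∀ {n} → N ≤ n → rank (f ↾ n) ≡ β) × Body (stage S α β) f
  eventual-rank f with wellFounded-minimal em wellFounded (λ γ → Σ ℕ λ n → rank (f ↾ n) ≡ γ)
                                                         (λ none → none _ (0 , refl))
  ... | .(rank (f ↾ N)) , (N , refl) , minimal = rank (f ↾ N) , N , stable , on-branch
    where
    on-branch : Body (stage S α (rank (f ↾ N))) f
    on-branch n = stage-antitone (λ lt → minimal lt (n , refl)) (stage-rank (f ↾ n))
    stable : ∀ {n} → N ≤ n → rank (f ↾ n) ≡ rank (f ↾ N)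
    stable {n} N≤n with compare (rank (f ↾ n)) (rank (f ↾ N))
    ... | tri< lt _ _ = ⊥-elim (minimal lt (n , refl))
    ... | tri≈ _ eq _ = eq
    ... | tri> _ _ gt = ⊥-elim (rank-antitone f N≤n gt)

  -- The prefixes of x of rank equal to rank x form a final segment, so this only asks about the
  -- shortest of them; that is what keeps the guess constant for as long as the rank is.
  Guess : Seq → Set
  Guess x = Σ ℕ λ k → k ≤ length x × rank (take k x) ≡ rank x × Branch S (rank (take k x)) (take k x)

  GuessAlong : Baire → ℕ → Set
  GuessAlong f n = Σ ℕ λ k → k ≤ n × rank (f ↾ k) ≡ rank (f ↾ n) × Branch S (rank (f ↾ k)) (f ↾ k)

  Guess-↾ : ∀ f n → Guess (f ↾ n) ⇔ GuessAlong f n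
  Guess-↾ f n = mk⇔ to from
    where
    to : Guess (f ↾ n) → GuessAlong f n
    to (k , k≤ , same , b) with subst (k ≤_) (length-↾ f n) k≤
    ... | k≤n rewrite take-↾ f k≤n = k , k≤n , same , b
    from : GuessAlong f n → Guess (f ↾ n)
    from (k , k≤n , same , b) rewrite sym (take-↾ f k≤n) =
      k , subst (k ≤_) (sym (length-↾ f n)) k≤n , same , b

  GuessAlong-suc : ∀ f n → rank (f ↾ suc n) ≡ rank (f ↾ n) → GuessAlong f (suc n) ⇔ GuessAlong f n
  GuessAlong-suc f n stay = mk⇔ to from
    where
    to : GuessAlong f (suc n) → GuessAlong f n
    to (k , k≤1+n , same , b) with m≤n⇒m<n∨m≡n k≤1+n
    ... | inj₁ (s≤s k≤n) = k , k≤n , trans same stay , b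
    ... | inj₂ refl      =
      n , ≤-refl , refl , subst (λ β → Branch S β (f ↾ n)) stay (Branch-↾ f (n≤1+n n) b)
    from : GuessAlong f n → GuessAlong f (suc n)
    from (k , k≤n , same , b) = k , m≤n⇒m≤1+n k≤n , trans same (sym stay) , b

  G : Seq → Bool
  G x = does (em {Guess x})

  G-guesses : IsGuesser S G
  G-guesses f with eventual-rank f
  ... | _ , N , stable , on-branch = in-S , not-in-S
    where
    on-branch-at : ∀ {n} → N ≤ n → Body (stage S α (rank (f ↾ n))) f
    on-branch-at N≤n = subst (λ γ → Body (stage S α γ) f) (sym (stable N≤n)) on-branch
    in-S : S f → LimitIs (λ n → G (f ↾ n)) true
    in-S sf = N , λ n N≤n → dec-true em (Equivalence.from (Guess-↾ f n)
                (n , ≤-refl , refl , f , on-branch-at N≤n , extends-self f n , sf))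
    no-guess : ¬ S f → ∀ {n} → N ≤ n → ¬ GuessAlong f n
    no-guess ¬sf N≤n (k , _ , same , b) = rank-unsplit (f ↾ k) b
      (f , subst (λ γ → Body (stage S α γ) f) (sym same) (on-branch-at N≤n) , extends-self f k , ¬sf)
    not-in-S : ¬ S f → LimitIs (λ n → G (f ↾ n)) false
    not-in-S ¬sf = N , λ n N≤n → dec-false em (no-guess ¬sf N≤n ∘ Equivalence.to (Guess-↾ f n))

  G-stays : ∀ f n → rank (f ↾ suc n) ≡ rank (f ↾ n) → G (f ↾ suc n) ≡ G (f ↾ n)
  G-stays f n stay = does-⇔ guess-stays em em
    where
    guess-stays : Guess (f ↾ suc n) ⇔ Guess (f ↾ n)
    guess-stays = ⇔.trans (Guess-↾ f (suc n)) (⇔.trans (GuessAlong-suc f n stay) (⇔.sym (Guess-↾ f n)))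

  rank-counts : CountsMindChanges α G rank
  rank-counts f n with compare (rank (f ↾ suc n)) (rank (f ↾ n))
  ... | tri< drop _ _ = inj₁ drop , λ _ → drop
  ... | tri≈ _ stay _ = inj₂ stay , λ changed → ⊥-elim (changed (G-stays f n stay))
  ... | tri> _ _ rise = ⊥-elim (rank-antitone f (n≤1+n n) rise)

  guessable : GuessableBelow S α
  guessable = G , rank , G-guesses , rank-counts

theorem3p2 : ExcludedMiddle 0ℓ → (S : Baire → Set) (α : Ordinal) →
    GuessableBelow S α ⇔ (∀ x → ¬ stageTop S α x)
theorem3p2 em S α = mk⇔
  (λ { (G , H , guesses , counts) → MindChangeBound.stageTop-empty S α G H guesses counts })
  (RankGuesser.guessable em S α)
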